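{- Let $\mathcal{S}=(S,\leq,\circ)$ be a $(\leq,\circ)$-structure in which $\circ$ is associative, $\leq$ is a partial order, and $\mathcal{S}$ satisfies $\sigma$. Let $\theta$ be the map defined below. Then for all $a,b\in S$, $(a\circ b)^\theta=a^\theta;b^\theta$.
   Context: For binary relations, $R;S=\{(x,y):\exists z\,((x,z)\in R\wedge(z,y)\in S)\}$. In a $(\leq,\circ)$-structure define for $n<\omega$: $a\blacktriangleleft_0 b\iff a\geq b\ \vee\ \exists c\,(a\geq b\circ c)$; $a\triangleleft^s_0 b\iff (a\leq b\wedge s=b)$; $a\blacktriangleleft_{n+1}b\iff a\triangleleft^a_n b\ \vee\ \exists c\,(a\blacktriangleleft_n c\wedge c\blacktriangleleft_n b)\ \vee\ \exists d,f,f'\,(a=d\circ f\wedge f\blacktriangleleft_n f'\wedge b=d\circ f')$; $a\triangleleft^s_{n+1}b\iff \exists c\,(a\triangleleft^s_n c\wedge c\triangleleft^s_n b)\ \vee\ \exists c,c',d,d'\,(a=c\circ d\wedge c\triangleleft^s_n c'\wedge d\triangleleft^d_n d'\wedge b=c'\circ d')\ \vee\ \exists s'\,(a\triangleleft^{s'}_n b\wedge s\blacktriangleleft_n s')$. $a\blacktriangleleft b$ iff $a\blacktriangleleft_n b$ for some $n$; $a\triangleleft^s b$ iff $a\triangleleft^s_n b$ for some $n$. $\sigma$ is the statement $\forall a,b\,((b\blacktriangleleft a\wedge a\triangleleft^b b)\rightarrow a\leq b)$. The map $\theta$: let $X=X_i\,\dot\cup\, X_f\,\dot\cup\, X_\beta$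 (disjoint union) where $X_i=\{(d_i,s_i): d,s\in S,\ d\blacktriangleleft s\}$, $X_f=\{s_f:s\in S\}$, $X_\beta=\{d_\beta:d\in S\}$ (formal copies). For $x\in X$ let $\delta(x)=d$ if $x\in\{(d_i,s_i),d_f,d_\beta\}$. For $x\in X_i\cup X_f$ let $\lambda(x)=s$ if $x\in\{(d_i,s_i),s_f\}$. For $a\in S$ define $a^\theta\subseteq X\times X$ by $(x,y)\in a^\theta$ iff (I) $y\notin X_i$; (II) if $x\in X_\beta$ then $y\in X_\beta$; (III) $\delta(x)\blacktriangleleft a\circ\delta(y)$; (IV) if $x\in X_i\cup X_f$ and $y\in X_f$ then $\lambda(x)\triangleleft^{\delta(x)} a\circ\lambda(y)$. -}

module Defs where

open import Data.Nat using (ℕ; zero; suc)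
open import Data.Product using (Σ; ∃; ∃-syntax; _×_; _,_)
open import Data.Sum using (_⊎_)
open import Data.Empty using (⊥)
open import Data.Unit using (⊤)
open import Relation.Binary.PropositionalEquality using (_≡_)
open import Relation.Binary.Structures using (IsPartialOrder)
open import Function.Bundles using (_⇔_)

record LeqCircStructure : Set₁ where
  field
    Carrier : Set
    _≤_     : Carrier → Carrier → Set
    _∘_     : Carrier → Carrier → Carrier

module _ (𝒮 : LeqCircStructure) where
  open LeqCircStructure 𝒮

  _≥_ : Carrier → Carrier → Set
  a ≥ b = b ≤ a

  -- ◀ₙ (blacktriangleleft_n) and ◁ₙ^s (triangleleft^s_n), by simultaneous
  -- recursion on n.  tri n s a b  means  a ◁ₙ^s b.
  btri : ℕ → Carrier → Carrier → Set
  tri  : ℕ → Carrier → Carrier → Carrier → Set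

  btri zero a b = (a ≥ b) ⊎ (∃[ c ] (a ≥ (b ∘ c)))
  btri (suc n) a b =
    tri n a a b
    ⊎ ((∃[ c ] (btri n a c × btri n c b))
    ⊎ (∃[ d ] ∃[ f ] ∃[ f' ] (a ≡ (d ∘ f) × btri n f f' × b ≡ (d ∘ f'))))

  tri zero s a b = (a ≤ b) × (s ≡ b)
  tri (suc n) s a b =
    (∃[ c ] (tri n s a c × tri n s c b))
    ⊎ ((∃[ c ] ∃[ c' ] ∃[ d ] ∃[ d' ]
          (a ≡ (c ∘ d) × tri n s c c' × tri n d d d' × b ≡ (c' ∘ d')))
    ⊎ (∃[ s' ] (tri n s' a b × btri n s s')))

  _◀_ : Carrier → Carrier → Set
  a ◀ b = ∃[ n ] btri n a b

  Tri : Carrier → Carrier → Carrier → Set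
  Tri s a b = ∃[ n ] tri n s a b

  σ : Set
  σ = ∀ a b → b ◀ a → Tri b a b → a ≤ b

  -- The base set X = X_i ⊍ X_f ⊍ X_β.
  -- xi d s p  is (d_i, s_i)  (with d ◀ s, witnessed by p);
  -- xf s is s_f;  xβ d is d_β.
  data X : Set where
    xi : (d s : Carrier) → d ◀ s → X
    xf : Carrier → X
    xβ : Carrier → X

  δ : X → Carrier
  δ (xi d s _) = d
  δ (xf d)     = d
  δ (xβ d)     = d

  notI : X → Set
  notI (xi _ _ _) = ⊥
  notI _          = ⊤

  condII : X → X → Set
  condII (xβ _) (xβ _) = ⊤
  condII (xβ _) _      = ⊥
  condII _      _      = ⊤

  condIV : Carrier → X → X → Set
  condIV a (xi d s _) (xf t) = Tri d s (a ∘ t)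
  condIV a (xf s)     (xf t) = Tri s s (a ∘ t)
  condIV a _          _      = ⊤

  θ : Carrier → X → X → Set
  θ a x y = notI y × condII x y × (δ x ◀ (a ∘ δ y)) × condIV a x y

  _⨾_ : (X → X → Set) → (X → X → Set) → X → X → Set
  (R ⨾ T) x y = ∃[ z ] (R x z × T z y)

  _≐_ : (X → X → Set) → (X → X → Set) → Set
  R ≐ T = ∀ x y → R x y ⇔ T x y

-- A pair (x , y) in (a ∘ b)^θ factors through the point b·y of the same kind as y whose
-- δ-value is b ∘ δ(y); by associativity it satisfies (III) and (IV) for a on the left,
-- and it is related to y by b^θ by reflexivity. Conversely, conditions (III) and (IV) of
-- a composite follow from the closure properties of ◀ and ◁: both are reflexive and
-- transitive, ◀ is compatible with d ∘ _, ◁ with _∘_, and the superscript of ◁ may be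
-- weakened along ◀.
module Submission where

open import Algebra.Definitions using (Associative)
open import Data.Nat using (ℕ; zero; suc; _⊔_; _≤′_; ≤′-refl; ≤′-step) renaming (_≤_ to _≤ℕ_)
open import Data.Nat.Properties using (m≤m⊔n; m≤n⊔m; ≤⇒≤′)
open import Data.Product using (_,_)
open import Data.Sum using (inj₁; inj₂)
open import Data.Unit using (tt)
open import Function.Bundles using (mk⇔)
open import Relation.Binary.Definitions using (Reflexive)
open import Relation.Binary.PropositionalEquality using (_≡_; refl; sym; subst)
open import Relation.Binary.Structures using (IsPartialOrder)
import Defs as D
open D using (LeqCircStructure; xi; xf; xβ; btri; tri; δ; notI; condII; condIV; θ; _⨾_)

module Notation (𝒮 : LeqCircStructure) where
  open LeqCircStructure 𝒮 public using (Carrier; _∘_)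

  infix 4 _◀_ _◁⟨_⟩_

  _◀_ : Carrier → Carrier → Set
  _◀_ = D._◀_ 𝒮

  _◁⟨_⟩_ : Carrier → Carrier → Carrier → Set
  a ◁⟨ s ⟩ b = D.Tri 𝒮 s a b

module ◀◁-Properties (𝒮 : LeqCircStructure) (≤-refl : Reflexive (LeqCircStructure._≤_ 𝒮)) where
  open Notation 𝒮

  private
    variable
      m n : ℕ
      a b c c' d d' f f' s s' : Carrier

  btri-refl : ∀ n a → btri 𝒮 n a a
  btri-refl zero a = inj₁ ≤-refl
  btri-refl (suc n) a = inj₂ (inj₁ (a , btri-refl n a , btri-refl n a))

  btri-step : btri 𝒮 n a b → btri 𝒮 (suc n) a b
  btri-step {n} {a} p = inj₂ (inj₁ (a , btri-refl n a , p))

  tri-step : tri 𝒮 n s a b → tri 𝒮 (suc n) s a b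
  tri-step {n} {s} p = inj₂ (inj₂ (s , p , btri-refl n s))

  btri-mono : m ≤ℕ n → btri 𝒮 m a b → btri 𝒮 n a b
  btri-mono m≤n = go (≤⇒≤′ m≤n)
    where
    go : m ≤′ n → btri 𝒮 m a b → btri 𝒮 n a b
    go ≤′-refl p = p
    go (≤′-step m≤′n) p = btri-step (go m≤′n p)

  tri-mono : m ≤ℕ n → tri 𝒮 m s a b → tri 𝒮 n s a b
  tri-mono m≤n = go (≤⇒≤′ m≤n)
    where
    go : m ≤′ n → tri 𝒮 m s a b → tri 𝒮 n s a b
    go ≤′-refl p = p
    go (≤′-step m≤′n) p = tri-step (go m≤′n p)

  ◀-refl : a ◀ a
  ◀-refl = 0 , inj₁ ≤-refl

  ◀-trans : a ◀ b → b ◀ c → a ◀ c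
  ◀-trans {b = b} (m , p) (n , q) =
    suc (m ⊔ n) , inj₂ (inj₁ (b , btri-mono (m≤m⊔n m n) p , btri-mono (m≤n⊔m m n) q))

  ◀-∘ˡ : ∀ d → f ◀ f' → (d ∘ f) ◀ (d ∘ f')
  ◀-∘ˡ d (n , p) = suc n , inj₂ (inj₂ (d , _ , _ , refl , p , refl))

  ∘-◀ : ∀ a b → (a ∘ b) ◀ a
  ∘-◀ a b = 0 , inj₂ (b , ≤-refl)

  ◁-refl : a ◁⟨ a ⟩ a
  ◁-refl = 0 , ≤-refl , refl

  ◁-trans : a ◁⟨ s ⟩ b → b ◁⟨ s ⟩ c → a ◁⟨ s ⟩ c
  ◁-trans {b = b} (m , p) (n , q) =
    suc (m ⊔ n) , inj₁ (b , tri-mono (m≤m⊔n m n) p , tri-mono (m≤n⊔m m n) q)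

  ◁-∘ : c ◁⟨ s ⟩ c' → d ◁⟨ d ⟩ d' → (c ∘ d) ◁⟨ s ⟩ (c' ∘ d')
  ◁-∘ {c} {s} {c'} {d} {d'} (m , p) (n , q) =
    suc (m ⊔ n) ,
    inj₂ (inj₁ (c , c' , d , d' , refl , tri-mono (m≤m⊔n m n) p , tri-mono (m≤n⊔m m n) q , refl))

  ◁-weaken : s ◀ s' → a ◁⟨ s' ⟩ b → a ◁⟨ s ⟩ b
  ◁-weaken {s' = s'} (m , p) (n , q) =
    suc (m ⊔ n) , inj₂ (inj₂ (s' , tri-mono (m≤n⊔m m n) q , btri-mono (m≤m⊔n m n) p))

module Composition (𝒮 : LeqCircStructure)
    (assoc : Associative _≡_ (LeqCircStructure._∘_ 𝒮))
    (≤-refl : Reflexive (LeqCircStructure._≤_ 𝒮)) where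
  open Notation 𝒮
  open ◀◁-Properties 𝒮 ≤-refl

  ◀-reassoc : ∀ {a b c d} → d ◀ ((a ∘ b) ∘ c) → d ◀ (a ∘ (b ∘ c))
  ◀-reassoc {a} {b} {c} = subst (_ ◀_) (assoc a b c)

  ◁-reassoc : ∀ {a b c d s} → s ◁⟨ d ⟩ ((a ∘ b) ∘ c) → s ◁⟨ d ⟩ (a ∘ (b ∘ c))
  ◁-reassoc {a} {b} {c} = subst (_ ◁⟨ _ ⟩_) (assoc a b c)

  ◀-∘-compose : ∀ {a b d e f} → d ◀ (a ∘ e) → e ◀ (b ∘ f) → d ◀ ((a ∘ b) ∘ f)
  ◀-∘-compose {a} {b} {f = f} p q =
    subst (_ ◀_) (sym (assoc a b f)) (◀-trans p (◀-∘ˡ a q))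

  -- a ◁ᵈ a holds because d ◀ a ∘ t ◀ a, so s ◁ᵈ a ∘ t ◁ᵈ a ∘ (b ∘ u).
  ◁-∘-compose : ∀ {a b d s t u} → d ◀ (a ∘ t) → s ◁⟨ d ⟩ (a ∘ t) → t ◁⟨ t ⟩ (b ∘ u)
              → s ◁⟨ d ⟩ ((a ∘ b) ∘ u)
  ◁-∘-compose {a} {b} {t = t} {u} d◀at s◁at t◁bu =
    subst (_ ◁⟨ _ ⟩_) (sym (assoc a b u))
      (◁-trans s◁at (◁-∘ (◁-weaken (◀-trans d◀at (∘-◀ a t)) ◁-refl) t◁bu))

  condII-trans : ∀ x z y → condII 𝒮 x z → condII 𝒮 z y → condII 𝒮 x y
  condII-trans (xi _ _ _) _ _ _ _ = tt
  condII-trans (xf _) _ _ _ _ = tt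
  condII-trans (xβ _) (xβ _) (xβ _) _ _ = tt

  θ-into-xβ : ∀ {c e} x → δ 𝒮 x ◀ (c ∘ e) → θ 𝒮 c x (xβ e)
  θ-into-xβ (xi _ _ _) p = tt , tt , p , tt
  θ-into-xβ (xf _) p = tt , tt , p , tt
  θ-into-xβ (xβ _) p = tt , tt , p , tt

  θ-xf-diagonal : ∀ c t → θ 𝒮 c (xf (c ∘ t)) (xf t)
  θ-xf-diagonal c t = tt , tt , ◀-refl , ◁-refl

  module _ (a b : Carrier) where

    ⨾⊆θ-∘ : ∀ x y → _⨾_ 𝒮 (θ 𝒮 a) (θ 𝒮 b) x y → θ 𝒮 (a ∘ b) x y
    ⨾⊆θ-∘ x y (z , (Iz , IIxz , IIIxz , IVxz) , (Iy , IIzy , IIIzy , IVzy)) =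
      Iy , condII-trans x z y IIxz IIzy , ◀-∘-compose IIIxz IIIzy ,
      condIV-compose x z y Iz IIzy IIIxz IVxz IVzy
      where
      condIV-compose : ∀ x z y → notI 𝒮 z → condII 𝒮 z y → δ 𝒮 x ◀ (a ∘ δ 𝒮 z)
                     → condIV 𝒮 a x z → condIV 𝒮 b z y → condIV 𝒮 (a ∘ b) x y
      condIV-compose (xβ _) _ _ _ _ _ _ _ = tt
      condIV-compose (xi _ _ _) _ (xi _ _ _) _ _ _ _ _ = tt
      condIV-compose (xi _ _ _) _ (xβ _) _ _ _ _ _ = tt
      condIV-compose (xf _) _ (xi _ _ _) _ _ _ _ _ = tt
      condIV-compose (xf _) _ (xβ _) _ _ _ _ _ = tt
      condIV-compose (xi _ _ _) (xf _) (xf _) _ _ p q r = ◁-∘-compose p q r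
      condIV-compose (xf _) (xf _) (xf _) _ _ p q r = ◁-∘-compose p q r
      condIV-compose _ (xi _ _ _) (xf _) () _ _ _ _
      condIV-compose _ (xβ _) (xf _) _ () _ _ _

    θ-∘⊆⨾ : ∀ x y → θ 𝒮 (a ∘ b) x y → _⨾_ 𝒮 (θ 𝒮 a) (θ 𝒮 b) x y
    θ-∘⊆⨾ x (xβ e) (_ , _ , III , _) =
      xβ (b ∘ e) , θ-into-xβ x (◀-reassoc III) , θ-into-xβ (xβ (b ∘ e)) ◀-refl
    θ-∘⊆⨾ (xi _ _ _) (xf t) (_ , _ , III , IV) =
      xf (b ∘ t) , (tt , tt , ◀-reassoc III , ◁-reassoc IV) , θ-xf-diagonal b t
    θ-∘⊆⨾ (xf _) (xf t) (_ , _ , III , IV) =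
      xf (b ∘ t) , (tt , tt , ◀-reassoc III , ◁-reassoc IV) , θ-xf-diagonal b t

open import Defs
open LeqCircStructure using (Carrier; _≤_; _∘_)

lemma6 : (𝒮 : LeqCircStructure)
    → (∀ a b c → _∘_ 𝒮 (_∘_ 𝒮 a b) c ≡ _∘_ 𝒮 a (_∘_ 𝒮 b c))
    → IsPartialOrder _≡_ (_≤_ 𝒮)
    → σ 𝒮
    → ∀ a b → _≐_ 𝒮 (θ 𝒮 (_∘_ 𝒮 a b)) (_⨾_ 𝒮 (θ 𝒮 a) (θ 𝒮 b))
lemma6 𝒮 assoc po _ a b x y = mk⇔ (θ-∘⊆⨾ a b x y) (⨾⊆θ-∘ a b x y)
  where open Composition 𝒮 assoc (IsPartialOrder.refl po) using (θ-∘⊆⨾; ⨾⊆θ-∘)
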